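{- Let $n\ge 0$, let $G$ be the empty graph on the vertex set $[n]=\{1,\dots,n\}$ (no edges and no loops), and let $H$ be a $3$-uniform hypergraph on $[n]$ such that $(G,H)$ generates a fusion ring. Then $n=2^k-1$ for some integer $k$, and $H$ is a Steiner triple system of order $2^k-1$ (every pair of distinct vertices lies in exactly one hyperedge). Furthermore, any two hypergraphs $H,H'$ such that $(G,H)$ and $(G,H')$ both generate fusion rings are isomorphic.
   Context: A fusion ring of rank $r$ (here always commutative) is a commutative unital ring, free as a $\mathbb{Z}$-module on a basis $X_0=1,X_1,\dots,X_{r-1}$, with $X_iX_j=\sum_k N_{ij}^kX_k$, $N_{ij}^k\in\mathbb{Z}_{\ge0}$, together with an involution $i\mapsto i^*$ of $\{0,\dots,r-1\}$ such that $N_{ij}^0=\delta_{i,j^*}$ and $N_{ij}^k=N_{jk^*}^{i^*}=N_{j^*i^*}^{k^*}$ for all $i,j,k$. It is self-dual if $i^*=i$ for all $i$, multiplicity-free if all $N_{ij}^k\in\{0,1\}$. For a self-dual multiplicity-free fusion ring of rank $n+1$, its associated pair $(D,H)$ on $[n]$ is: $D$ the digraph (loops allowed) with a loop at $i$ iff $N_{ii}^i=1$ and, for $i\ne j$, an arc $(i,j)$ iff $N_{ii}^j=1$; $H$ the $3$-uniform hypergraph with hyperedge $\{i,j,k\}$ ($i,j,k$ distinct) iff $N_{ij}^k=1$. A pair $(D,H)$ on $[n]$ generates a fusion ring if it is the associated pair of some self-dual multiplicity-free fusion ring of rank $n+1$. An undirected graph is identified with the digraph having both arcs $(i,j),(j,i)$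 for each edge $\{i,j\}$. -}

module Defs where

open import Data.Nat using (ℕ; zero; suc; _+_; _*_; _≤_)
open import Data.Fin using (Fin; zero; suc; _≟_)
open import Data.Fin.Subset using (Subset; ⁅_⁆; _∪_; _∈_; ∣_∣)
open import Data.Product using (Σ; ∃; ∃-syntax; _×_; _,_; ∃!)
open import Data.Empty using (⊥)
open import Data.Bool using (if_then_else_)
open import Relation.Nullary using (¬_)
open import Relation.Nullary.Decidable using (⌊_⌋)
open import Relation.Binary.PropositionalEquality using (_≡_)
open import Function.Bundles using (_⇔_; _↔_; Inverse)

∑ : ∀ {r} → (Fin r → ℕ) → ℕ
∑ {zero}  f = 0
∑ {suc r} f = f zero + ∑ (λ i → f (suc i))

δ : ∀ {r} → Fin r → Fin r → ℕ
δ i j = if ⌊ i ≟ j ⌋ then 1 else 0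

-- A commutative fusion ring of rank (suc m), given by its structure
-- constants N i j k = N_{ij}^k on the basis X_0 = 1, X_1, ..., X_m
-- (index zero is the unit), with involution dual (i ↦ i*).
record FusionRing (m : ℕ) : Set where
  field
    N      : Fin (suc m) → Fin (suc m) → Fin (suc m) → ℕ
    unitˡ  : ∀ j k → N zero j k ≡ δ j k
    unitʳ  : ∀ i k → N i zero k ≡ δ i k
    assoc  : ∀ i j k l →
             ∑ (λ p → N i j p * N p k l) ≡ ∑ (λ p → N j k p * N i p l)
    comm   : ∀ i j k → N i j k ≡ N j i k
    dual   : Fin (suc m) → Fin (suc m)
    dual-invol : ∀ i → dual (dual i) ≡ i
    N-zero : ∀ i j → N i j zero ≡ δ i (dual j)
    frob₁  : ∀ i j k → N i j k ≡ N j (dual k) (dual i)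
    frob₂  : ∀ i j k → N i j k ≡ N (dual j) (dual i) (dual k)

open FusionRing public

SelfDual : ∀ {m} → FusionRing m → Set
SelfDual R = ∀ i → dual R i ≡ i

MultiplicityFree : ∀ {m} → FusionRing m → Set
MultiplicityFree R = ∀ i j k → N R i j k ≤ 1

Digraph : ℕ → Set₁
Digraph n = Fin n → Fin n → Set

emptyGraph : (n : ℕ) → Digraph n
emptyGraph n _ _ = ⊥

record Hypergraph3 (n : ℕ) : Set₁ where
  field
    Edge    : Subset n → Set
    uniform : ∀ s → Edge s → ∣ s ∣ ≡ 3

open Hypergraph3 public

triple : ∀ {n} → Fin n → Fin n → Fin n → Subset n
triple i j k = ⁅ i ⁆ ∪ ⁅ j ⁆ ∪ ⁅ k ⁆

Distinct3 : ∀ {n} → Fin n → Fin n → Fin n → Set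
Distinct3 i j k = ¬ i ≡ j × ¬ j ≡ k × ¬ i ≡ k

-- (D , H) is the associated pair of the fusion ring R of rank n+1
-- (vertex i ∈ [n] corresponds to the basis element X_{suc i}).
IsAssociatedPair : ∀ {n} → FusionRing n → Digraph n → Hypergraph3 n → Set
IsAssociatedPair {n} R D H =
  (∀ i j → D i j ⇔ (N R (suc i) (suc i) (suc j) ≡ 1)) ×
  (∀ s → Edge H s ⇔
     (∃[ i ] ∃[ j ] ∃[ k ] (Distinct3 i j k × s ≡ triple i j k ×
        N R (suc i) (suc j) (suc k) ≡ 1)))

Generates : ∀ {n} → Digraph n → Hypergraph3 n → Set
Generates {n} D H =
  ∃[ R ] (SelfDual {n} R × MultiplicityFree R × IsAssociatedPair R D H)

SteinerTripleSystem : ∀ {n} → Hypergraph3 n → Set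
SteinerTripleSystem {n} H =
  ∀ (i j : Fin n) → ¬ i ≡ j → ∃! _≡_ (λ s → Edge H s × i ∈ s × j ∈ s)

Isomorphic : ∀ {n} → Hypergraph3 n → Hypergraph3 n → Set
Isomorphic {n} H H' =
  Σ (Fin n ↔ Fin n) λ σ →
    let f = Inverse.to σ in
    ∀ i j k → Edge H (triple i j k) ⇔ Edge H' (triple (f i) (f j) (f k))

-- With no arcs, every basis element squares to the unit: X_a X_a = X_0.  Frobenius
-- reciprocity and associativity then give ∑_p N_{ab}^p = ∑_p N_{ab}^p N_{pb}^a, the
-- coefficient of X_a in X_a X_b X_b = X_a, which is 1; in a multiplicity-free ring every
-- product X_a X_b is therefore a single basis element.  So the basis is an elementary abelian
-- 2-group of order n + 1 = 2^k (an F₂-vector space with a basis found greedily), and the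
-- hyperedges are the triples {a, b, ab} of non-identity elements, i.e. the lines of
-- PG(k − 1, 2): two points lie on exactly one line.  Two elementary abelian 2-groups of the
-- same order are isomorphic by matching bases; the isomorphism fixes the identity and hence
-- relabels the vertices, carrying one triple system onto the other.

module Submission where

open import Defs
open import Data.Nat using (ℕ; zero; suc; _+_; _*_; _^_; _≤_; _<_; z≤n; s≤s)
open import Data.Nat.Properties
  using ( ≤∧≢⇒<; ≤-reflexive; n<1⇒n≡0; m+n≡0⇒m≡0; m+n≡0⇒n≡0; +-identityʳ; +-suc
        ; m<m+n; m^n>0; <-≤-trans; <⇒≢)
  renaming (suc-injective to ℕ-suc-injective)
open import Data.Nat.Logarithm using (⌊log₂_⌋; ⌊log₂[2^n]⌋≡n)
open import Data.Bool using (Bool; true; false; _xor_)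
open import Data.Fin using (Fin; zero; suc; _≟_; punchIn)
open import Data.Fin.Properties using (suc-injective; injective⇒≤; all?; ¬∀⟶∃¬; 2↔Bool; *↔×)
open import Data.Fin.Subset using (⁅_⁆; _∪_; _∈_; _⊆_)
open import Data.Fin.Subset.Properties
  using (anySubset?; x∈⁅x⁆; x∈⁅y⁆⇒x≡y; x∈p∪q⁻; x∈p∪q⁺; ⊆-antisym; ∪-comm; ∪-assoc)
open import Data.Fin.Permutation using (↔⇒≡; remove; punchIn-permute)
open import Data.Vec using (Vec; []; _∷_; zipWith)
open import Data.Product using (Σ-syntax; ∃-syntax; _×_; _,_; proj₁; proj₂; uncurry)
open import Data.Sum using (_⊎_; inj₁; inj₂) renaming (map to ⊎-map)
open import Data.Product.Function.NonDependent.Propositional using (_×-↔_)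
open import Algebra.Morphism.Definitions using (Homomorphic₂)
open import Function using (_∘_)
open import Function.Bundles using (_↔_; _⇔_; Inverse; Equivalence; mk↔ₛ′; mk⇔; Injection)
open import Function.Definitions using (Injective)
open import Function.Properties.Inverse using (↔-sym; ↔-trans; ↔⇒↣)
open import Relation.Nullary using (¬_; Dec; yes; no; contradiction)
open import Relation.Binary.PropositionalEquality

δ-refl : ∀ {r} (i : Fin r) → δ i i ≡ 1
δ-refl i with i ≟ i
... | yes _   = refl
... | no i≢i = contradiction refl i≢i

δ≡1⇒≡ : ∀ {r} {i j : Fin r} → δ i j ≡ 1 → i ≡ j
δ≡1⇒≡ {i = i} {j} δ≡1 with i ≟ j
... | yes i≡j = i≡j

δ-suc : ∀ {r} (i j : Fin r) → δ (suc i) (suc j) ≡ δ i j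
δ-suc i j with i ≟ j
... | yes _ = refl
... | no _  = refl

∑-cong : ∀ {r} {f g : Fin r → ℕ} → (∀ i → f i ≡ g i) → ∑ f ≡ ∑ g
∑-cong {zero}  f≡g = refl
∑-cong {suc r} f≡g = cong₂ _+_ (f≡g zero) (∑-cong (f≡g ∘ suc))

∑-0 : ∀ r → ∑ {r} (λ _ → 0) ≡ 0
∑-0 zero    = refl
∑-0 (suc r) = ∑-0 r

∑-δ : ∀ {r} (c : Fin r) (f : Fin r → ℕ) → ∑ (λ p → δ c p * f p) ≡ f c
∑-δ {suc r} zero    f = trans (cong₂ _+_ (+-identityʳ (f zero)) (∑-0 r)) (+-identityʳ (f zero))
∑-δ {suc r} (suc c) f = trans (∑-cong (λ p → cong (_* f (suc p)) (δ-suc c p))) (∑-δ c (f ∘ suc))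

∑≡0⇒≡0 : ∀ {r} (f : Fin r → ℕ) → ∑ f ≡ 0 → ∀ i → f i ≡ 0
∑≡0⇒≡0 f ∑≡0 zero    = m+n≡0⇒m≡0 (f zero) ∑≡0
∑≡0⇒≡0 f ∑≡0 (suc i) = ∑≡0⇒≡0 (f ∘ suc) (m+n≡0⇒n≡0 (f zero) ∑≡0) i

∑≡1⇒δ : ∀ {r} (f : Fin r → ℕ) → (∀ i → f i ≤ 1) → ∑ f ≡ 1 → ∃[ c ] (∀ d → f d ≡ δ c d)
∑≡1⇒δ {suc r} f f≤1 ∑≡1 with f zero in f₀ | f≤1 zero
... | 0 | _ =
  let c , f∘suc≡δ = ∑≡1⇒δ (f ∘ suc) (f≤1 ∘ suc) ∑≡1
  in suc c , λ { zero → f₀ ; (suc d) → trans (f∘suc≡δ d) (sym (δ-suc c d)) }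
... | 1 | _ = zero , λ { zero → f₀ ; (suc d) → ∑≡0⇒≡0 (f ∘ suc) (ℕ-suc-injective ∑≡1) d }

record IsBooleanGroup {A : Set} (_∙_ : A → A → A) (ε : A) : Set where
  field
    ∙-identityˡ   : ∀ x → ε ∙ x ≡ x
    ∙-assoc       : ∀ x y z → (x ∙ y) ∙ z ≡ x ∙ (y ∙ z)
    ∙-comm        : ∀ x y → x ∙ y ≡ y ∙ x
    ∙-selfInverse : ∀ x → x ∙ x ≡ ε

  ∙-identityʳ : ∀ x → x ∙ ε ≡ x
  ∙-identityʳ x = trans (∙-comm x ε) (∙-identityˡ x)

  ∙-solveʳ : ∀ {x y z} → x ∙ y ≡ z → x ∙ z ≡ y
  ∙-solveʳ {x} {y} refl = begin
    x ∙ (x ∙ y)  ≡⟨ ∙-assoc x x y ⟨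
    (x ∙ x) ∙ y  ≡⟨ cong (_∙ y) (∙-selfInverse x) ⟩
    ε ∙ y        ≡⟨ ∙-identityˡ y ⟩
    y            ∎
    where open ≡-Reasoning

  ∙-cancelˡ : ∀ {x y z} → x ∙ y ≡ x ∙ z → y ≡ z
  ∙-cancelˡ e = trans (sym (∙-solveʳ e)) (∙-solveʳ refl)

  ∙≡ε⇒≡ : ∀ {x y} → x ∙ y ≡ ε → x ≡ y
  ∙≡ε⇒≡ {x} e = trans (sym (∙-identityʳ x)) (∙-solveʳ e)

  ∙≡ˡ⇒≡ε : ∀ {x y} → x ∙ y ≡ x → y ≡ ε
  ∙≡ˡ⇒≡ε {x} e = trans (sym (∙-solveʳ e)) (∙-selfInverse x)

  ∙-exchange : ∀ x y z → x ∙ (y ∙ z) ≡ y ∙ (x ∙ z)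
  ∙-exchange x y z = begin
    x ∙ (y ∙ z)  ≡⟨ ∙-assoc x y z ⟨
    (x ∙ y) ∙ z  ≡⟨ cong (_∙ z) (∙-comm x y) ⟩
    (y ∙ x) ∙ z  ≡⟨ ∙-assoc y x z ⟩
    y ∙ (x ∙ z)  ∎
    where open ≡-Reasoning

  ∙-interchange : ∀ x y z w → (x ∙ y) ∙ (z ∙ w) ≡ (x ∙ z) ∙ (y ∙ w)
  ∙-interchange x y z w = begin
    (x ∙ y) ∙ (z ∙ w)  ≡⟨ ∙-assoc x y (z ∙ w) ⟩
    x ∙ (y ∙ (z ∙ w))  ≡⟨ cong (x ∙_) (∙-exchange y z w) ⟩
    x ∙ (z ∙ (y ∙ w))  ≡⟨ ∙-assoc x z (y ∙ w) ⟨
    (x ∙ z) ∙ (y ∙ w)  ∎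
    where open ≡-Reasoning

-- Fusion rings whose basis elements square to the unit

SquaresToUnit : ∀ {m} → FusionRing m → Set
SquaresToUnit R = ∀ a c → N R a a c ≡ δ zero c

noArcs⇒squaresToUnit : ∀ {m} (R : FusionRing m) → SelfDual R → MultiplicityFree R →
                       (∀ i j → ¬ N R (suc i) (suc i) (suc j) ≡ 1) → SquaresToUnit R
noArcs⇒squaresToUnit R selfDual multFree noArc zero    c       = unitˡ R zero c
noArcs⇒squaresToUnit R selfDual multFree noArc (suc i) zero    =
  trans (N-zero R (suc i) (suc i)) (trans (cong (δ (suc i)) (selfDual (suc i))) (δ-refl (suc i)))
noArcs⇒squaresToUnit R selfDual multFree noArc (suc i) (suc j) =
  n<1⇒n≡0 (≤∧≢⇒< (multFree (suc i) (suc i) (suc j)) (noArc i j))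

≤1⇒*-idem : ∀ {x} → x ≤ 1 → x * x ≡ x
≤1⇒*-idem z≤n       = refl
≤1⇒*-idem (s≤s z≤n) = refl

module BasisProduct {m} (R : FusionRing m) (selfDual : SelfDual R)
                    (multFree : MultiplicityFree R) (squares : SquaresToUnit R) where

  N-rotate : ∀ i j k → N R i j k ≡ N R j k i
  N-rotate i j k = trans (frob₁ R i j k) (cong₂ (N R j) (selfDual k) (selfDual i))

  ∑N≡1 : ∀ a b → ∑ (N R a b) ≡ 1
  ∑N≡1 a b = begin
    ∑ (N R a b)                      ≡⟨ ∑-cong N≡N*N ⟩
    ∑ (λ p → N R a b p * N R p b a)  ≡⟨ assoc R a b b a ⟩
    ∑ (λ p → N R b b p * N R a p a)  ≡⟨ ∑-cong (λ p → cong (_* N R a p a) (squares b p)) ⟩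
    ∑ (λ p → δ zero p * N R a p a)   ≡⟨ ∑-δ zero (λ p → N R a p a) ⟩
    N R a zero a                     ≡⟨ unitʳ R a a ⟩
    δ a a                            ≡⟨ δ-refl a ⟩
    1                                ∎
    where
      open ≡-Reasoning
      N≡N*N : ∀ p → N R a b p ≡ N R a b p * N R p b a
      N≡N*N p = begin
        N R a b p                  ≡⟨ ≤1⇒*-idem (multFree a b p) ⟨
        N R a b p * N R a b p      ≡⟨ cong (N R a b p *_) (comm R a b p) ⟩
        N R a b p * N R b a p      ≡⟨ cong (N R a b p *_) (N-rotate p b a) ⟨
        N R a b p * N R p b a      ∎

  infixl 7 _·_
  _·_ : Fin (suc m) → Fin (suc m) → Fin (suc m)
  a · b = proj₁ (∑≡1⇒δ (N R a b) (multFree a b) (∑N≡1 a b))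

  N≡δ· : ∀ a b d → N R a b d ≡ δ (a · b) d
  N≡δ· a b = proj₂ (∑≡1⇒δ (N R a b) (multFree a b) (∑N≡1 a b))

  N≡1⇒· : ∀ {a b c} → N R a b c ≡ 1 → a · b ≡ c
  N≡1⇒· {a} {b} {c} N≡1 = δ≡1⇒≡ (trans (sym (N≡δ· a b c)) N≡1)

  ·⇒N≡1 : ∀ {a b c} → a · b ≡ c → N R a b c ≡ 1
  ·⇒N≡1 {a} {b} refl = trans (N≡δ· a b (a · b)) (δ-refl (a · b))

  ∑N-sift : ∀ a b (f : Fin (suc m) → ℕ) → ∑ (λ p → N R a b p * f p) ≡ f (a · b)
  ∑N-sift a b f = trans (∑-cong (λ p → cong (_* f p) (N≡δ· a b p))) (∑-δ (a · b) f)

  ·-isBooleanGroup : IsBooleanGroup _·_ zero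
  ·-isBooleanGroup = record
    { ∙-identityˡ   = λ a → N≡1⇒· (trans (unitˡ R a a) (δ-refl a))
    ; ∙-assoc       = ·-assoc
    ; ∙-comm        = λ a b → N≡1⇒· (trans (comm R a b (b · a)) (·⇒N≡1 refl))
    ; ∙-selfInverse = λ a → N≡1⇒· (squares a zero)
    }
    where
      ·-assoc : ∀ a b c → a · b · c ≡ a · (b · c)
      ·-assoc a b c = sym (N≡1⇒· (begin
        N R a (b · c) l                  ≡⟨ ∑N-sift b c (λ p → N R a p l) ⟨
        ∑ (λ p → N R b c p * N R a p l)  ≡⟨ assoc R a b c l ⟨
        ∑ (λ p → N R a b p * N R p c l)  ≡⟨ ∑N-sift a b (λ p → N R p c l) ⟩
        N R (a · b) c l                  ≡⟨ ·⇒N≡1 refl ⟩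
        1                                ∎))
        where
          open ≡-Reasoning
          l = a · b · c

-- Coordinates of finite Boolean groups

infixl 6 _⊕_
_⊕_ : ∀ {k} → Vec Bool k → Vec Bool k → Vec Bool k
_⊕_ = zipWith _xor_

module _ {A : Set} {_∙_ : A → A → A} {ε : A} (G : IsBooleanGroup _∙_ ε) where
  open IsBooleanGroup G

  selectedProduct : ∀ {k} → Vec A k → Vec Bool k → A
  selectedProduct []       []           = ε
  selectedProduct (g ∷ gs) (false ∷ bs) = selectedProduct gs bs
  selectedProduct (g ∷ gs) (true ∷ bs)  = g ∙ selectedProduct gs bs

  selectedProduct-⊕ : ∀ {k} (gs : Vec A k) → Homomorphic₂ (Vec Bool k) A _≡_ (selectedProduct gs) _⊕_ _∙_
  selectedProduct-⊕ []       []          []          = sym (∙-selfInverse ε)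
  selectedProduct-⊕ (g ∷ gs) (false ∷ u) (false ∷ v) = selectedProduct-⊕ gs u v
  selectedProduct-⊕ (g ∷ gs) (false ∷ u) (true ∷ v)  =
    trans (cong (g ∙_) (selectedProduct-⊕ gs u v)) (∙-exchange g _ _)
  selectedProduct-⊕ (g ∷ gs) (true ∷ u)  (false ∷ v) =
    trans (cong (g ∙_) (selectedProduct-⊕ gs u v)) (sym (∙-assoc g _ _))
  selectedProduct-⊕ (g ∷ gs) (true ∷ u)  (true ∷ v)  = begin
    selectedProduct gs (u ⊕ v)  ≡⟨ selectedProduct-⊕ gs u v ⟩
    x ∙ y                      ≡⟨ ∙-identityˡ (x ∙ y) ⟨
    ε ∙ (x ∙ y)                ≡⟨ cong (_∙ (x ∙ y)) (∙-selfInverse g) ⟨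
    (g ∙ g) ∙ (x ∙ y)          ≡⟨ ∙-interchange g g x y ⟩
    (g ∙ x) ∙ (g ∙ y)          ∎
    where
      open ≡-Reasoning
      x = selectedProduct gs u
      y = selectedProduct gs v

  Independent : ∀ {k} → Vec A k → Set
  Independent gs = Injective _≡_ _≡_ (selectedProduct gs)

  Spanning : ∀ {k} → Vec A k → Set
  Spanning gs = ∀ a → ∃[ bs ] selectedProduct gs bs ≡ a

  independent-∷ : ∀ {k} {gs : Vec A k} {h} → Independent gs →
                  (∀ bs → ¬ selectedProduct gs bs ≡ h) → Independent (h ∷ gs)
  independent-∷ {gs = gs} {h} independent h∉span {u} {v} = extend u v
    where
      spans : ∀ u v → h ∙ selectedProduct gs u ≡ selectedProduct gs v → selectedProduct gs (u ⊕ v) ≡ h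
      spans u v e = trans (selectedProduct-⊕ gs u v) (∙-solveʳ (trans (∙-comm _ h) e))

      extend : ∀ u v → selectedProduct (h ∷ gs) u ≡ selectedProduct (h ∷ gs) v → u ≡ v
      extend (false ∷ u) (false ∷ v) e = cong (false ∷_) (independent e)
      extend (true ∷ u)  (true ∷ v)  e = cong (true ∷_) (independent (∙-cancelˡ e))
      extend (true ∷ u)  (false ∷ v) e = contradiction (spans u v e) (h∉span (u ⊕ v))
      extend (false ∷ u) (true ∷ v)  e = contradiction (spans v u (sym e)) (h∉span (v ⊕ u))

bits↔Fin : ∀ k → Vec Bool k ↔ Fin (2 ^ k)
bits↔Fin zero    = mk↔ₛ′ (λ _ → zero) (λ _ → []) (λ { zero → refl }) (λ { [] → refl })
bits↔Fin (suc k) = ↔-trans ∷↔× (↔-trans (↔-sym 2↔Bool ×-↔ bits↔Fin k) (↔-sym *↔×))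
  where
    ∷↔× : Vec Bool (suc k) ↔ (Bool × Vec Bool k)
    ∷↔× = mk↔ₛ′ (λ { (b ∷ bs) → b , bs }) (uncurry _∷_) (λ _ → refl) (λ { (_ ∷ _) → refl })

n<2^n : ∀ n → n < 2 ^ n
n<2^n zero    = s≤s z≤n
n<2^n (suc n) = <-≤-trans (s≤s (n<2^n n)) (m<m+n (2 ^ n) 0<2^n+0)
  where
    0<2^n+0 : 0 < 2 ^ n + 0
    0<2^n+0 = <-≤-trans (m^n>0 2 n) (≤-reflexive (sym (+-identityʳ (2 ^ n))))

2^-injective : ∀ {m n} → 2 ^ m ≡ 2 ^ n → m ≡ n
2^-injective {m} {n} e = trans (sym (⌊log₂[2^n]⌋≡n m)) (trans (cong ⌊log₂_⌋ e) (⌊log₂[2^n]⌋≡n n))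

module _ {r} {_∙_ : Fin r → Fin r → Fin r} {ε : Fin r} (G : IsBooleanGroup _∙_ ε) where

  independent⇒2^k≤r : ∀ {k} (gs : Vec (Fin r) k) → Independent G gs → 2 ^ k ≤ r
  independent⇒2^k≤r {k} gs independent =
    injective⇒≤ (Injection.injective (↔⇒↣ (↔-sym (bits↔Fin k))) ∘ independent)

  independent⇒k<r : ∀ {k} (gs : Vec (Fin r) k) → Independent G gs → k < r
  independent⇒k<r {k} gs independent = <-≤-trans (n<2^n k) (independent⇒2^k≤r gs independent)

  spanned? : ∀ {k} (gs : Vec (Fin r) k) a → Dec (∃[ bs ] selectedProduct G gs bs ≡ a)
  spanned? gs a = anySubset? (λ bs → selectedProduct G gs bs ≟ a)

  -- Greedy extension of an independent family; the fuel runs out only when k = r, which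
  -- independence (2 ^ k ≤ r) forbids.
  basis : ∀ fuel {k} (gs : Vec (Fin r) k) → k + fuel ≡ r → Independent G gs →
          ∃[ k′ ] Σ[ gs′ ∈ Vec (Fin r) k′ ] (Independent G gs′ × Spanning G gs′)
  basis zero {k} gs k+0≡r independent =
    contradiction (trans (sym (+-identityʳ k)) k+0≡r) (<⇒≢ (independent⇒k<r gs independent))
  basis (suc fuel) {k} gs k+fuel≡r independent with all? (spanned? gs)
  ... | yes spanning   = k , gs , independent , spanning
  ... | no ¬spanning with ¬∀⟶∃¬ r _ (spanned? gs) ¬spanning
  ...   | h , h∉span =
    basis fuel (h ∷ gs) (trans (sym (+-suc k fuel)) k+fuel≡r)
          (independent-∷ G independent (λ bs e → h∉span (bs , e)))

  Coordinates : ℕ → Set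
  Coordinates k = Σ[ ψ ∈ Vec Bool k ↔ Fin r ] Homomorphic₂ (Vec Bool k) (Fin r) _≡_ (Inverse.to ψ) _⊕_ _∙_

  coordinates : ∃[ k ] Coordinates k
  coordinates with basis r [] refl (λ { {[]} {[]} _ → refl })
  ... | k , gs , independent , spanning =
    k , mk↔ₛ′ (selectedProduct G gs) (proj₁ ∘ spanning) (proj₂ ∘ spanning)
              (λ u → independent (proj₂ (spanning (selectedProduct G gs u))))
      , selectedProduct-⊕ G gs

  coordinates⇒2^k≡r : ∀ {k} → Coordinates k → 2 ^ k ≡ r
  coordinates⇒2^k≡r {k} (ψ , _) = ↔⇒≡ (↔-trans (↔-sym (bits↔Fin k)) ψ)

from-homomorphic : ∀ {A B : Set} {_∙_ : A → A → A} {_∘_ : B → B → B} (f : A ↔ B) →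
                   Homomorphic₂ A B _≡_ (Inverse.to f) _∙_ _∘_ →
                   Homomorphic₂ B A _≡_ (Inverse.from f) _∘_ _∙_
from-homomorphic {_∙_ = _∙_} {_∘_} f f-hom x y = begin
  from (x ∘ y)                        ≡⟨ cong from (cong₂ _∘_ (strictlyInverseˡ x) (strictlyInverseˡ y)) ⟨
  from (to (from x) ∘ to (from y))    ≡⟨ cong from (f-hom (from x) (from y)) ⟨
  from (to (from x ∙ from y))         ≡⟨ strictlyInverseʳ (from x ∙ from y) ⟩
  from x ∙ from y                     ∎
  where
    open Inverse f
    open ≡-Reasoning

homomorphic⇒ε≡ε : ∀ {A B : Set} {_∙_ : A → A → A} {_∘_ : B → B → B} {ε ε′} {f : A → B} →
                  IsBooleanGroup _∙_ ε → IsBooleanGroup _∘_ ε′ →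
                  Homomorphic₂ A B _≡_ f _∙_ _∘_ → f ε ≡ ε′
homomorphic⇒ε≡ε {ε = ε} {f = f} G G′ f-hom =
  trans (cong f (sym (∙-selfInverse G ε))) (trans (f-hom ε ε) (∙-selfInverse G′ (f ε)))
  where open IsBooleanGroup

booleanGroups-isomorphic : ∀ {r} {_∙_ _∘_ : Fin r → Fin r → Fin r} {ε ε′} →
                           IsBooleanGroup _∙_ ε → IsBooleanGroup _∘_ ε′ →
                           Σ[ π ∈ Fin r ↔ Fin r ] Homomorphic₂ (Fin r) (Fin r) _≡_ (Inverse.to π) _∙_ _∘_
booleanGroups-isomorphic G G′ with coordinates G | coordinates G′
... | k , coords@(ψ , ψ-hom) | k′ , coords′@(ψ′ , ψ′-hom)
  with 2^-injective {k} {k′} (trans (coordinates⇒2^k≡r G coords) (sym (coordinates⇒2^k≡r G′ coords′)))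
... | refl = ↔-trans (↔-sym ψ) ψ′ ,
             λ x y → trans (cong (Inverse.to ψ′) (from-homomorphic ψ ψ-hom x y)) (ψ′-hom _ _)

∈-triple⁻ : ∀ {n} {x a b c : Fin n} → x ∈ triple a b c → x ≡ a ⊎ x ≡ b ⊎ x ≡ c
∈-triple⁻ {a = a} {b} {c} x∈ with x∈p∪q⁻ ⁅ a ⁆ (⁅ b ⁆ ∪ ⁅ c ⁆) x∈
... | inj₁ x∈a  = inj₁ (x∈⁅y⁆⇒x≡y a x∈a)
... | inj₂ x∈bc = inj₂ (⊎-map (x∈⁅y⁆⇒x≡y b) (x∈⁅y⁆⇒x≡y c) (x∈p∪q⁻ ⁅ b ⁆ ⁅ c ⁆ x∈bc))

∈-triple⁺ : ∀ {n} {x a b c : Fin n} → x ≡ a ⊎ x ≡ b ⊎ x ≡ c → x ∈ triple a b c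
∈-triple⁺ (inj₁ refl)        = x∈p∪q⁺ (inj₁ (x∈⁅x⁆ _))
∈-triple⁺ (inj₂ (inj₁ refl)) = x∈p∪q⁺ (inj₂ (x∈p∪q⁺ (inj₁ (x∈⁅x⁆ _))))
∈-triple⁺ (inj₂ (inj₂ refl)) = x∈p∪q⁺ (inj₂ (x∈p∪q⁺ (inj₂ (x∈⁅x⁆ _))))

triple-swap₁₂ : ∀ {n} (a b c : Fin n) → triple a b c ≡ triple b a c
triple-swap₁₂ a b c = begin
  ⁅ a ⁆ ∪ (⁅ b ⁆ ∪ ⁅ c ⁆)  ≡⟨ ∪-assoc ⁅ a ⁆ ⁅ b ⁆ ⁅ c ⁆ ⟨
  (⁅ a ⁆ ∪ ⁅ b ⁆) ∪ ⁅ c ⁆  ≡⟨ cong (_∪ ⁅ c ⁆) (∪-comm ⁅ a ⁆ ⁅ b ⁆) ⟩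
  (⁅ b ⁆ ∪ ⁅ a ⁆) ∪ ⁅ c ⁆  ≡⟨ ∪-assoc ⁅ b ⁆ ⁅ a ⁆ ⁅ c ⁆ ⟩
  ⁅ b ⁆ ∪ (⁅ a ⁆ ∪ ⁅ c ⁆)  ∎
  where open ≡-Reasoning

triple-swap₂₃ : ∀ {n} (a b c : Fin n) → triple a b c ≡ triple a c b
triple-swap₂₃ a b c = cong (⁅ a ⁆ ∪_) (∪-comm ⁅ b ⁆ ⁅ c ⁆)

∈-triple-image : ∀ {n m} (g : Fin n → Fin m) {x a b c} →
                 x ∈ triple a b c → g x ∈ triple (g a) (g b) (g c)
∈-triple-image g x∈ = ∈-triple⁺ (⊎-map (cong g) (⊎-map (cong g) (cong g)) (∈-triple⁻ x∈))

triple-image-⊆ : ∀ {n m} (g : Fin n → Fin m) {i j k a b c} → triple i j k ⊆ triple a b c →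
                 triple (g i) (g j) (g k) ⊆ triple (g a) (g b) (g c)
triple-image-⊆ g ijk⊆abc y∈ with ∈-triple⁻ y∈
... | inj₁ refl        = ∈-triple-image g (ijk⊆abc (∈-triple⁺ (inj₁ refl)))
... | inj₂ (inj₁ refl) = ∈-triple-image g (ijk⊆abc (∈-triple⁺ (inj₂ (inj₁ refl))))
... | inj₂ (inj₂ refl) = ∈-triple-image g (ijk⊆abc (∈-triple⁺ (inj₂ (inj₂ refl))))

triple-image : ∀ {n m} (g : Fin n → Fin m) {i j k a b c} → triple i j k ≡ triple a b c →
               triple (g i) (g j) (g k) ≡ triple (g a) (g b) (g c)
triple-image g e =
  ⊆-antisym (triple-image-⊆ g (subst (_ ∈_) e)) (triple-image-⊆ g (subst (_ ∈_) (sym e)))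

Ternary : ℕ → Set₁
Ternary n = Fin n → Fin n → Fin n → Set

record EdgesGivenBy {n} (T : Ternary n) (H : Hypergraph3 n) : Set where
  field
    edge⇔ : ∀ s → Edge H s ⇔ (∃[ i ] ∃[ j ] ∃[ k ] (Distinct3 i j k × s ≡ triple i j k × T i j k))

  edge⇒ : ∀ {s} → Edge H s → ∃[ i ] ∃[ j ] ∃[ k ] (Distinct3 i j k × s ≡ triple i j k × T i j k)
  edge⇒ = Equivalence.to (edge⇔ _)

  ⇒edge : ∀ {i j k} → Distinct3 i j k → T i j k → Edge H (triple i j k)
  ⇒edge {i} {j} {k} d t = Equivalence.from (edge⇔ _) (i , j , k , d , refl , t)

open EdgesGivenBy

EdgesGivenBy-cong : ∀ {n} {T T′ : Ternary n} {H} → (∀ {i j k} → T i j k ⇔ T′ i j k) →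
                    EdgesGivenBy T H → EdgesGivenBy T′ H
EdgesGivenBy-cong T⇔T′ edges .edge⇔ s = mk⇔
  (λ edge → let i , j , k , d , e , t = edge⇒ edges edge in i , j , k , d , e , Equivalence.to T⇔T′ t)
  (λ { (i , j , k , d , refl , t) → ⇒edge edges d (Equivalence.from T⇔T′ t) })

module _ {n} {T : Ternary n}
         (swap₁₂ : ∀ {a b c} → T a b c → T b a c)
         (swap₂₃ : ∀ {a b c} → T a b c → T a c b)
         (functional : ∀ {a b c c′} → T a b c → T a b c′ → c ≡ c′) where

  triple-unique : ∀ {a b c i j k} → T a b c → i ∈ triple a b c → j ∈ triple a b c → ¬ i ≡ j →
                  T i j k → triple i j k ≡ triple a b c
  triple-unique t i∈ j∈ = go t (∈-triple⁻ i∈) (∈-triple⁻ j∈)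
    where
      go : ∀ {a b c i j k} → T a b c → i ≡ a ⊎ i ≡ b ⊎ i ≡ c → j ≡ a ⊎ j ≡ b ⊎ j ≡ c → ¬ i ≡ j →
           T i j k → triple i j k ≡ triple a b c
      go t (inj₁ refl)        (inj₁ refl)        i≢j _ = contradiction refl i≢j
      go t (inj₂ (inj₁ refl)) (inj₂ (inj₁ refl)) i≢j _ = contradiction refl i≢j
      go t (inj₂ (inj₂ refl)) (inj₂ (inj₂ refl)) i≢j _ = contradiction refl i≢j
      go t (inj₁ refl) (inj₂ (inj₁ refl)) _ t′
        rewrite functional t′ t = refl
      go {a} {b} {c} t (inj₁ refl) (inj₂ (inj₂ refl)) _ t′
        rewrite functional t′ (swap₂₃ t) = sym (triple-swap₂₃ a b c)
      go {a} {b} {c} t (inj₂ (inj₁ refl)) (inj₁ refl) _ t′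
        rewrite functional t′ (swap₁₂ t) = sym (triple-swap₁₂ a b c)
      go {a} {b} {c} t (inj₂ (inj₁ refl)) (inj₂ (inj₂ refl)) _ t′
        rewrite functional t′ (swap₂₃ (swap₁₂ t)) =
          sym (trans (triple-swap₁₂ a b c) (triple-swap₂₃ b a c))
      go {a} {b} {c} t (inj₂ (inj₂ refl)) (inj₁ refl) _ t′
        rewrite functional t′ (swap₁₂ (swap₂₃ t)) =
          sym (trans (triple-swap₂₃ a b c) (triple-swap₁₂ a c b))
      go {a} {b} {c} t (inj₂ (inj₂ refl)) (inj₂ (inj₁ refl)) _ t′
        rewrite functional t′ (swap₁₂ (swap₂₃ (swap₁₂ t))) =
          sym (trans (triple-swap₁₂ a b c) (trans (triple-swap₂₃ b a c) (triple-swap₁₂ b c a)))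

  steinerTripleSystem : ∀ {H} → (∀ {i j} → ¬ i ≡ j → ∃[ k ] (¬ j ≡ k × ¬ i ≡ k × T i j k)) →
                        EdgesGivenBy T H → SteinerTripleSystem H
  steinerTripleSystem {H} total edges i j i≢j with total i≢j
  ... | k , j≢k , i≢k , t =
    triple i j k , (edge , ∈-triple⁺ (inj₁ refl) , ∈-triple⁺ (inj₂ (inj₁ refl))) , unique
    where
      edge : Edge H (triple i j k)
      edge = ⇒edge edges (i≢j , j≢k , i≢k) t

      unique : ∀ {s} → Edge H s × i ∈ s × j ∈ s → triple i j k ≡ s
      unique (edge′ , i∈s , j∈s) with edge⇒ edges edge′
      ... | _ , _ , _ , _ , refl , t′ = triple-unique t′ i∈s j∈s i≢j t

relabel : ∀ {n} {T T′ : Ternary n} {H H′} → EdgesGivenBy T H → EdgesGivenBy T′ H′ →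
          (g : Fin n → Fin n) → Injective _≡_ _≡_ g → (∀ {a b c} → T a b c → T′ (g a) (g b) (g c)) →
          ∀ {i j k} → Edge H (triple i j k) → Edge H′ (triple (g i) (g j) (g k))
relabel {H′ = H′} edges edges′ g g-injective g-T edge with edge⇒ edges edge
... | a , b , c , (a≢b , b≢c , a≢c) , e , t =
  subst (Edge H′) (sym (triple-image g e))
    (⇒edge edges′ (a≢b ∘ g-injective , b≢c ∘ g-injective , a≢c ∘ g-injective) (g-T t))

subst₃ : ∀ {A : Set} {ℓ} (P : A → A → A → Set ℓ) {x x′ y y′ z z′} →
         x ≡ x′ → y ≡ y′ → z ≡ z′ → P x y z → P x′ y′ z′
subst₃ P refl refl refl p = p

isomorphic : ∀ {n} {T T′ : Ternary n} {H H′} → EdgesGivenBy T H → EdgesGivenBy T′ H′ →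
             (σ : Fin n ↔ Fin n) →
             (∀ {a b c} → T a b c ⇔ T′ (Inverse.to σ a) (Inverse.to σ b) (Inverse.to σ c)) →
             Isomorphic H H′
isomorphic {T = T} {T′} {H} edges edges′ σ T⇔T′ = σ , λ i j k → mk⇔
  (relabel edges edges′ to (Injection.injective (↔⇒↣ σ)) (Equivalence.to T⇔T′))
  (subst₃ (λ x y z → Edge H (triple x y z))
          (strictlyInverseʳ i) (strictlyInverseʳ j) (strictlyInverseʳ k)
   ∘ relabel edges′ edges from (Injection.injective (↔⇒↣ (↔-sym σ))) T′⇒T)
  where
    open Inverse σ
    T′⇒T : ∀ {a b c} → T′ a b c → T (from a) (from b) (from c)
    T′⇒T {a} {b} {c} =
      Equivalence.from T⇔T′
      ∘ subst₃ T′ (sym (strictlyInverseˡ a)) (sym (strictlyInverseˡ b)) (sym (strictlyInverseˡ c))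

-- The triple system of a Boolean group

ProductTriple : ∀ {n} → (Fin (suc n) → Fin (suc n) → Fin (suc n)) → Ternary n
ProductTriple _∙_ a b c = suc a ∙ suc b ≡ suc c

module _ {n} {_∙_ : Fin (suc n) → Fin (suc n) → Fin (suc n)} (G : IsBooleanGroup _∙_ zero) where
  open IsBooleanGroup G

  productTriple-total : ∀ {i j} → ¬ i ≡ j → ∃[ k ] (¬ j ≡ k × ¬ i ≡ k × ProductTriple _∙_ i j k)
  productTriple-total {i} {j} i≢j with suc i ∙ suc j in e
  ... | zero  = contradiction (suc-injective (∙≡ε⇒≡ e)) i≢j
  ... | suc k = k
              , (λ { refl → contradiction (∙≡ˡ⇒≡ε (trans (∙-comm (suc j) (suc i)) e)) λ () })
              , (λ { refl → contradiction (∙≡ˡ⇒≡ε e) λ () })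
              , refl

  booleanGroup⇒steinerTripleSystem : ∀ {H} → EdgesGivenBy (ProductTriple _∙_) H → SteinerTripleSystem H
  booleanGroup⇒steinerTripleSystem =
    steinerTripleSystem {T = ProductTriple _∙_}
      (trans (∙-comm _ _)) ∙-solveʳ (λ t t′ → suc-injective (trans (sym t) t′)) productTriple-total

productTriple-relabel : ∀ {n} {_∙_ _∘_ : Fin (suc n) → Fin (suc n) → Fin (suc n)} →
                        IsBooleanGroup _∙_ zero → IsBooleanGroup _∘_ zero →
                        (π : Fin (suc n) ↔ Fin (suc n)) →
                        Homomorphic₂ (Fin (suc n)) (Fin (suc n)) _≡_ (Inverse.to π) _∙_ _∘_ →
                        let σ = Inverse.to (remove zero π) in
                        ∀ {a b c} → ProductTriple _∙_ a b c ⇔ ProductTriple _∘_ (σ a) (σ b) (σ c)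
productTriple-relabel {_∙_ = _∙_} {_∘_} G G′ π π-hom {a} {b} {c} = mk⇔
  (λ t → trans (sym (π-product a b)) (trans (cong to t) (π-suc c)))
  (λ t′ → Injection.injective (↔⇒↣ π) (trans (π-product a b) (trans t′ (sym (π-suc c)))))
  where
    open Inverse π
    σ = Inverse.to (remove zero π)

    π-suc : ∀ i → to (suc i) ≡ suc (σ i)
    π-suc i = trans (punchIn-permute π zero i)
                    (cong (λ z → punchIn z (σ i)) (homomorphic⇒ε≡ε G G′ π-hom))

    π-product : ∀ a b → to (suc a ∙ suc b) ≡ suc (σ a) ∘ suc (σ b)
    π-product a b = trans (π-hom (suc a) (suc b)) (cong₂ _∘_ (π-suc a) (π-suc b))

generates⇒booleanGroup : ∀ {n} {H : Hypergraph3 n} → Generates (emptyGraph n) H →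
                         Σ[ _∙_ ∈ (Fin (suc n) → Fin (suc n) → Fin (suc n)) ]
                           (IsBooleanGroup _∙_ zero × EdgesGivenBy (ProductTriple _∙_) H)
generates⇒booleanGroup (R , selfDual , multFree , arcs , edges) =
  _·_ , ·-isBooleanGroup , EdgesGivenBy-cong (mk⇔ N≡1⇒· ·⇒N≡1) (record { edge⇔ = edges })
  where
    open BasisProduct R selfDual multFree
                      (noArcs⇒squaresToUnit R selfDual multFree (λ i j → Equivalence.from (arcs i j)))

mainTheorem2 : (n : ℕ) →
    ((H : Hypergraph3 n) → Generates (emptyGraph n) H →
       (∃[ k ] (suc n ≡ 2 ^ k)) × SteinerTripleSystem H) ×
    ((H H' : Hypergraph3 n) → Generates (emptyGraph n) H →
       Generates (emptyGraph n) H' → Isomorphic H H')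
mainTheorem2 n = orderAndSteiner , uniqueUpToIsomorphism
  where
    orderAndSteiner : (H : Hypergraph3 n) → Generates (emptyGraph n) H →
                      (∃[ k ] (suc n ≡ 2 ^ k)) × SteinerTripleSystem H
    orderAndSteiner H generates with generates⇒booleanGroup {H = H} generates
    ... | _∙_ , G , edges with coordinates G
    ...   | k , ψ = (k , sym (coordinates⇒2^k≡r G ψ)) , booleanGroup⇒steinerTripleSystem G edges

    uniqueUpToIsomorphism : (H H′ : Hypergraph3 n) → Generates (emptyGraph n) H →
                            Generates (emptyGraph n) H′ → Isomorphic H H′
    uniqueUpToIsomorphism H H′ generates generates′
      with generates⇒booleanGroup {H = H} generates | generates⇒booleanGroup {H = H′} generates′
    ... | _∙_ , G , edges | _∘_ , G′ , edges′ with booleanGroups-isomorphic G G′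
    ...   | π , π-hom = isomorphic edges edges′ (remove zero π) (productTriple-relabel G G′ π π-hom)
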